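{- Let $G$ be a finite group and $H$ a normal subgroup of $G$ containing $G'$ such that $|H|$ divides $[G:H]$. Then the diagram \[ \begin{array}{ccc} G/H & \xrightarrow{\ \widetilde{\operatorname{Ver}}\ } & H/H'\\ \downarrow{\scriptstyle \delta|_H} & & \downarrow{\scriptstyle \delta}\\ \dfrac{I_G/I_G^2}{\delta(H/G')} & \xrightarrow{\ S'\ } & \dfrac{I_H+I_GI_H}{I_GI_H} \end{array} \] commutes, i.e. $S'\circ\delta|_H=\delta\circ\widetilde{\operatorname{Ver}}$.
   Context: $I_G$ is the augmentation ideal of $\mathbb{Z}[G]$ (kernel of $\sum n_\sigma\sigma\mapsto\sum n_\sigma$), and $I_H\subseteq I_G$ similarly. The map $\delta\colon G/G'\to I_G/I_G^2$, $\sigma G'\mapsto(\sigma-1)+I_G^2$, and the map $\delta\colon H/H'\to (I_H+I_GI_H)/I_GI_H$, $hH'\mapsto (h-1)+I_GI_H$. Since $G/H\cong (G/G')/(H/G')$, $\delta|_H\colon G/H\to (I_G/I_G^2)/\delta(H/G')$ is the map induced by $\delta$. With $g_1,\dots,g_n$ coset representatives of $H$ in $G$, $S\colon I_G/I_G^2\to (I_H+I_GI_H)/I_GI_H$ is $S(x)=x\cdot(g_1+\dots+g_n)\bmod I_GI_H$, and $S'([x])=S(x)$ is the induced map on the quotient by $\delta(H/G')$. The transfer $\operatorname{Ver}(g)=\prod_i\phi(gg_i)^{ -1}gg_i$ (with $\phi(g)$ the chosen representative of $gH$) induces $\operatorname{Ver}(G\to H)\colon G/G'\to H/H'$, and $\widetilde{\operatorname{Ver}}\colon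 G/H\to H/H'$ is the induced map $gH\mapsto\operatorname{Ver}(g)H'$. -}

module Defs where

open import Level using (0ℓ)
open import Data.Nat using (ℕ; zero; suc)
open import Data.Fin using (Fin; zero; suc; _≟_)
open import Data.Integer as ℤ using (ℤ; 0ℤ; 1ℤ)
open import Data.List using (List; []; _∷_; foldr; filter; length; allFin)
open import Data.Product using (Σ; ∃; _×_; _,_)
open import Function using (_∘_)
open import Algebra.Structures using (IsGroup)
open import Relation.Binary.PropositionalEquality using (_≡_)
open import Relation.Nullary using (¬_; yes; no)
open import Relation.Unary using (Pred; Decidable)

record FinGroup : Set where
  infixl 7 _∙_
  infix 8 _⁻¹
  field
    n       : ℕ
    _∙_     : Fin n → Fin n → Fin n
    e       : Fin n
    _⁻¹     : Fin n → Fin n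
    isGroup : IsGroup _≡_ _∙_ e _⁻¹

module _ (G : FinGroup) where
  open FinGroup G

  El : Set
  El = Fin n

  record NormalSubgroup : Set₁ where
    field
      mem    : Pred El 0ℓ
      mem?   : Decidable mem
      e∈     : mem e
      ∙∈     : ∀ {a b} → mem a → mem b → mem (a ∙ b)
      ⁻¹∈    : ∀ {a} → mem a → mem (a ⁻¹)
      normal : ∀ g {h} → mem h → mem ((g ∙ h) ∙ (g ⁻¹))

  comm : El → El → El
  comm a b = ((a ⁻¹ ∙ b ⁻¹) ∙ a) ∙ b

  data Derived : El → Set where
    d-e   : Derived e
    d-com : ∀ a b {x} → Derived x → Derived (comm a b ∙ x)
    d-inv : ∀ a b {x} → Derived x → Derived ((comm a b) ⁻¹ ∙ x)

  prodFin : ∀ {k} → (Fin k → El) → El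
  prodFin {zero}  f = e
  prodFin {suc k} f = f zero ∙ prodFin (f ∘ suc)

  -- Integer group ring ℤ[G], elements as functions G → ℤ (G finite)
  ZG : Set
  ZG = El → ℤ

  sumℤ : ∀ {k} → (Fin k → ℤ) → ℤ
  sumℤ {zero}  f = 0ℤ
  sumℤ {suc k} f = f zero ℤ.+ sumℤ (f ∘ suc)

  zeroG : ZG
  zeroG _ = 0ℤ

  _+G_ : ZG → ZG → ZG
  (x +G y) k = x k ℤ.+ y k

  _-G_ : ZG → ZG → ZG
  (x -G y) k = x k ℤ.- y k

  basis : El → ZG
  basis g k with g ≟ k
  ... | yes _ = 1ℤ
  ... | no  _ = 0ℤ

  _*G_ : ZG → ZG → ZG
  (x *G y) k = sumℤ (λ a → x a ℤ.* y (a ⁻¹ ∙ k))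

  aug : ZG → ℤ
  aug x = sumℤ x

  δ : El → ZG
  δ g = basis g -G basis e

  sumZG : ∀ {k} → (Fin k → ZG) → ZG
  sumZG {zero}  f = zeroG
  sumZG {suc k} f = f zero +G sumZG (f ∘ suc)

  module _ (H : NormalSubgroup) where
    open NormalSubgroup H

    card : ℕ
    card = length (filter mem? (allFin n))

    IsTransversal : (m : ℕ) → (Fin m → El) → Set
    IsTransversal m reps =
      (∀ g → ∃ λ i → mem (reps i ⁻¹ ∙ g)) ×
      (∀ i j g → mem (reps i ⁻¹ ∙ g) → mem (reps j ⁻¹ ∙ g) → i ≡ j)

    -- φ(g): the chosen representative of gH (default e if none found)
    φ : ∀ {m} → (Fin m → El) → El → El
    φ {zero}  reps g = e
    φ {suc m} reps g with mem? (reps zero ⁻¹ ∙ g)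
    ... | yes _ = reps zero
    ... | no  _ = φ (reps ∘ suc) g

    Ver : ∀ {m} → (Fin m → El) → El → El
    Ver reps g = prodFin (λ i → (φ reps (g ∙ reps i)) ⁻¹ ∙ (g ∙ reps i))

    InIG : ZG → Set
    InIG x = aug x ≡ 0ℤ

    InIH : ZG → Set
    InIH x = (∀ g → ¬ mem g → x g ≡ 0ℤ) × (aug x ≡ 0ℤ)

    record IdealPair : Set where
      field
        a  : ZG
        b  : ZG
        a∈ : InIG a
        b∈ : InIH b

    sumPairs : List IdealPair → ZG
    sumPairs = foldr (λ p acc → (IdealPair.a p *G IdealPair.b p) +G acc) zeroG

    InIGIH : ZG → Set
    InIGIH x = Σ (List IdealPair) λ ps → ∀ k → x k ≡ sumPairs ps k

-- Write g·gᵢ = pᵢ·hᵢ with pᵢ = φ(g·gᵢ) and hᵢ ∈ H. Left multiplication by g permutes the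
-- cosets, so i ↦ pᵢ permutes the transversal and, in ℤ[G],
--   (g − 1)·Σ gᵢ = Σ (pᵢhᵢ − pᵢ) = Σ (hᵢ − 1) + Σ (pᵢ − 1)(hᵢ − 1).
-- The last sum lies in I_G I_H, and ab − 1 = (a − 1) + (b − 1) + (a − 1)(b − 1) shows that
-- Σ (hᵢ − 1) ≡ ∏ hᵢ − 1 = Ver(g) − 1 modulo I_H I_H ⊆ I_G I_H.
module Submission where

open import Defs
open import Level using (0ℓ)
open import Data.Nat using (ℕ; zero; suc)
open import Data.Nat.Divisibility using (_∣_)
open import Data.Fin using (Fin; zero; suc; _≟_; punchIn)
open import Data.Fin.Properties using (punchInᵢ≢i; suc-injective)
open import Data.Fin.Permutation using (Permutation′; permutation)
open import Data.Integer using (ℤ; 0ℤ; 1ℤ; -1ℤ; _+_; _*_; -_; _-_)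
open import Data.Integer.Properties
  using (+-*-semiring; +-*-ring; +-identityˡ; +-identityʳ; +-assoc; *-identityˡ;
         -1*i≡-i; neg-distrib-+; neg-distribˡ-*)
open import Data.Integer.Tactic.RingSolver using (solve-∀)
open import Data.List using ([]; _∷_; _++_; map)
open import Data.Product using (_,_; proj₁; proj₂)
open import Function using (_∘_)
open import Relation.Binary.PropositionalEquality
open import Relation.Nullary using (¬_; yes; no; contradiction)
open import Algebra.Bundles using (Group)
open import Algebra.Structures using (IsGroup)
import Algebra.Properties.Group as GroupProperties
open import Algebra.Properties.Ring +-*-ring using ([y-z]x≈yx-zx)
open import Algebra.Properties.Semiring.Sum +-*-semiring
  using (sum; sum-cong-≗; ∑-distrib-+; *-distribˡ-sum; sum-remove; sum-replicate-zero; sum-permute)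

open ≡-Reasoning

sum-neg : ∀ {k} (f : Fin k → ℤ) → sum (λ i → - f i) ≡ - sum f
sum-neg f = begin
  sum (λ i → - f i)      ≡⟨ sum-cong-≗ (λ i → sym (-1*i≡-i (f i))) ⟩
  sum (λ i → -1ℤ * f i)  ≡⟨ *-distribˡ-sum -1ℤ f ⟨
  -1ℤ * sum f            ≡⟨ -1*i≡-i (sum f) ⟩
  - sum f                ∎

sum-sub : ∀ {k} (f f′ : Fin k → ℤ) → sum (λ i → f i - f′ i) ≡ sum f - sum f′
sum-sub f f′ = trans (∑-distrib-+ f (λ i → - f′ i)) (cong (sum f +_) (sum-neg f′))

sum-supported : ∀ {k} (i : Fin k) (f : Fin k → ℤ) → (∀ j → j ≢ i → f j ≡ 0ℤ) → sum f ≡ f i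
sum-supported {suc k} i f vanishes = begin
  sum f                      ≡⟨ sum-remove {i = i} f ⟩
  f i + sum (f ∘ punchIn i)
    ≡⟨ cong (f i +_) (sum-cong-≗ {k} (λ j → vanishes (punchIn i j) (punchInᵢ≢i i j))) ⟩
  f i + sum {k} (λ _ → 0ℤ)   ≡⟨ cong (f i +_) (sum-replicate-zero k) ⟩
  f i + 0ℤ                   ≡⟨ +-identityʳ (f i) ⟩
  f i                        ∎

module _ (G : FinGroup) where
  open FinGroup G
  open IsGroup isGroup using (assoc; identityˡ; identityʳ)

  group : Group 0ℓ 0ℓ
  group = record { _≈_ = _≡_ ; _∙_ = _∙_ ; ε = e ; _⁻¹ = _⁻¹ ; isGroup = isGroup }

  open GroupProperties group
    using (ε⁻¹≈ε; ⁻¹-involutive; ⁻¹-anti-homo-∙; ⁻¹-anti-homo-\\; \\-leftDividesˡ; \\-leftDividesʳ)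

  e⁻¹∙x≡x : ∀ x → e ⁻¹ ∙ x ≡ x
  e⁻¹∙x≡x x = trans (cong (_∙ x) ε⁻¹≈ε) (identityˡ x)

  sumℤ≡sum : ∀ {k} (f : Fin k → ℤ) → sumℤ G f ≡ sum f
  sumℤ≡sum {zero}  f = refl
  sumℤ≡sum {suc k} f = cong (f zero +_) (sumℤ≡sum (f ∘ suc))

  sumZG-apply : ∀ {k} (f : Fin k → ZG G) x → sumZG G f x ≡ sum (λ i → f i x)
  sumZG-apply {zero}  f x = refl
  sumZG-apply {suc k} f x = cong (f zero x +_) (sumZG-apply (f ∘ suc) x)

  infixl 6 _⊕_ _⊖_
  infixl 7 _·_
  infix 8 ⊝_

  _⊕_ _⊖_ _·_ : ZG G → ZG G → ZG G
  _⊕_ = _+G_ G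
  _⊖_ = _-G_ G
  _·_ = _*G_ G

  ⊝_ : ZG G → ZG G
  (⊝ x) k = - x k

  basis-self : ∀ a → basis G a a ≡ 1ℤ
  basis-self a with a ≟ a
  ... | yes _   = refl
  ... | no  a≢a = contradiction refl a≢a

  basis-≢ : ∀ {a c} → a ≢ c → basis G a c ≡ 0ℤ
  basis-≢ {a} {c} a≢c with a ≟ c
  ... | yes a≡c = contradiction a≡c a≢c
  ... | no  _   = refl

  basis-resp : ∀ {a c a′ c′} → (a ≡ c → a′ ≡ c′) → (a′ ≡ c′ → a ≡ c) →
               basis G a c ≡ basis G a′ c′
  basis-resp {a} {c} {a′} {c′} to from with a ≟ c | a′ ≟ c′
  ... | yes _ | yes _ = refl
  ... | yes p | no ¬q = contradiction (to p) ¬q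
  ... | no ¬p | yes q = contradiction (from q) ¬p
  ... | no _  | no _  = refl

  basis-translate : ∀ a r k → basis G r (a ⁻¹ ∙ k) ≡ basis G (a ∙ r) k
  basis-translate a r k =
    basis-resp (λ r≡a⁻¹k → trans (cong (a ∙_) r≡a⁻¹k) (\\-leftDividesˡ a k))
               (λ ar≡k → trans (sym (\\-leftDividesʳ a r)) (cong (a ⁻¹ ∙_) ar≡k))

  sum-basis-* : ∀ a (F : El G → ℤ) → sum (λ c → basis G a c * F c) ≡ F a
  sum-basis-* a F = begin
    sum (λ c → basis G a c * F c)
      ≡⟨ sum-supported a _ (λ c c≢a → cong (_* F c) (basis-≢ (c≢a ∘ sym))) ⟩
    basis G a a * F a  ≡⟨ cong (_* F a) (basis-self a) ⟩
    1ℤ * F a           ≡⟨ *-identityˡ (F a) ⟩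
    F a                ∎

  sum-basis : ∀ a → sum (basis G a) ≡ 1ℤ
  sum-basis a = trans (sum-supported a _ (λ c c≢a → basis-≢ (c≢a ∘ sym))) (basis-self a)

  aug-δ : ∀ a → aug G (δ G a) ≡ 0ℤ
  aug-δ a = begin
    sumℤ G (δ G a)                     ≡⟨ sumℤ≡sum (δ G a) ⟩
    sum (δ G a)                        ≡⟨ sum-sub (basis G a) (basis G e) ⟩
    sum (basis G a) - sum (basis G e)  ≡⟨ cong₂ _-_ (sum-basis a) (sum-basis e) ⟩
    1ℤ - 1ℤ                            ≡⟨⟩
    0ℤ                                 ∎

  ·-apply : ∀ x y k → (x · y) k ≡ sum (λ c → x c * y (c ⁻¹ ∙ k))
  ·-apply x y k = sumℤ≡sum {n} _

  δ·-apply : ∀ a y k → (δ G a · y) k ≡ y (a ⁻¹ ∙ k) - y k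
  δ·-apply a y k = begin
    (δ G a · y) k
      ≡⟨ ·-apply (δ G a) y k ⟩
    sum (λ c → (basis G a c - basis G e c) * y′ c)
      ≡⟨ sum-cong-≗ (λ c → [y-z]x≈yx-zx (y′ c) (basis G a c) (basis G e c)) ⟩
    sum (λ c → basis G a c * y′ c - basis G e c * y′ c)
      ≡⟨ sum-sub (λ c → basis G a c * y′ c) (λ c → basis G e c * y′ c) ⟩
    sum (λ c → basis G a c * y′ c) - sum (λ c → basis G e c * y′ c)
      ≡⟨ cong₂ _-_ (sum-basis-* a y′) (sum-basis-* e y′) ⟩
    y (a ⁻¹ ∙ k) - y (e ⁻¹ ∙ k)
      ≡⟨ cong (λ z → y (a ⁻¹ ∙ k) - y z) (e⁻¹∙x≡x k) ⟩
    y (a ⁻¹ ∙ k) - y k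
      ∎
    where
    y′ : El G → ℤ
    y′ c = y (c ⁻¹ ∙ k)

  ⊝·-apply : ∀ x y k → ((⊝ x) · y) k ≡ - (x · y) k
  ⊝·-apply x y k = begin
    ((⊝ x) · y) k                       ≡⟨ ·-apply (⊝ x) y k ⟩
    sum (λ c → - x c * y (c ⁻¹ ∙ k))    ≡⟨ sum-cong-≗ (λ c → neg-distribˡ-* (x c) (y (c ⁻¹ ∙ k))) ⟨
    sum (λ c → - (x c * y (c ⁻¹ ∙ k)))  ≡⟨ sum-neg (λ c → x c * y (c ⁻¹ ∙ k)) ⟩
    - sum (λ c → x c * y (c ⁻¹ ∙ k))    ≡⟨ cong -_ (·-apply x y k) ⟨
    - (x · y) k                         ∎

  δ·δ-apply : ∀ a b k → (δ G a · δ G b) k ≡ basis G (a ∙ b) k - basis G a k - δ G b k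
  δ·δ-apply a b k = begin
    (δ G a · δ G b) k
      ≡⟨ δ·-apply a (δ G b) k ⟩
    basis G b (a ⁻¹ ∙ k) - basis G e (a ⁻¹ ∙ k) - δ G b k
      ≡⟨ cong (_- δ G b k) (cong₂ _-_ (basis-translate a b k) (basis-translate a e k)) ⟩
    basis G (a ∙ b) k - basis G (a ∙ e) k - δ G b k
      ≡⟨ cong (λ x → basis G (a ∙ b) k - basis G x k - δ G b k) (identityʳ a) ⟩
    basis G (a ∙ b) k - basis G a k - δ G b k
      ∎

  δ-∙ : ∀ a b → δ G (a ∙ b) ≗ δ G a ⊕ δ G b ⊕ δ G a · δ G b
  δ-∙ a b k = trans (expand (basis G a k) (basis G b k) (basis G (a ∙ b) k) (basis G e k))
                    (cong (δ G a k + δ G b k +_) (sym (δ·δ-apply a b k)))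
    where
    expand : ∀ xa xb xab xe → xab - xe ≡ (xa - xe) + (xb - xe) + (xab - xa - (xb - xe))
    expand = solve-∀

  basis-∙-sub : ∀ a b → basis G (a ∙ b) ⊖ basis G a ≗ δ G b ⊕ δ G a · δ G b
  basis-∙-sub a b k = trans (expand (basis G a k) (basis G b k) (basis G (a ∙ b) k) (basis G e k))
                            (cong (δ G b k +_) (sym (δ·δ-apply a b k)))
    where
    expand : ∀ xa xb xab xe → xab - xa ≡ (xb - xe) + (xab - xa - (xb - xe))
    expand = solve-∀

  module _ (H : NormalSubgroup G) where
    open NormalSubgroup H

    InIGIH-resp : ∀ {x y} → x ≗ y → InIGIH G H x → InIGIH G H y
    InIGIH-resp x≗y (ps , x≗ps) = ps , λ k → trans (sym (x≗y k)) (x≗ps k)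

    InIGIH-zero : InIGIH G H (zeroG G)
    InIGIH-zero = [] , λ _ → refl

    InIGIH-· : ∀ {a b} → InIG G H a → InIH G H b → InIGIH G H (a · b)
    InIGIH-· {a} {b} a∈ b∈ =
      record { a = a ; b = b ; a∈ = a∈ ; b∈ = b∈ } ∷ [] , λ k → sym (+-identityʳ _)

    sumPairs-++ : ∀ ps qs k → sumPairs G H (ps ++ qs) k ≡ sumPairs G H ps k + sumPairs G H qs k
    sumPairs-++ []       qs k = sym (+-identityˡ _)
    sumPairs-++ (p ∷ ps) qs k = begin
      (a · b) k + sumPairs G H (ps ++ qs) k                ≡⟨ cong ((a · b) k +_) (sumPairs-++ ps qs k) ⟩
      (a · b) k + (sumPairs G H ps k + sumPairs G H qs k)  ≡⟨ +-assoc ((a · b) k) _ _ ⟨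
      (a · b) k + sumPairs G H ps k + sumPairs G H qs k    ∎
      where open IdealPair p

    InIGIH-⊕ : ∀ {x y} → InIGIH G H x → InIGIH G H y → InIGIH G H (x ⊕ y)
    InIGIH-⊕ (ps , x≗ps) (qs , y≗qs) =
      ps ++ qs , λ k → trans (cong₂ _+_ (x≗ps k) (y≗qs k)) (sym (sumPairs-++ ps qs k))

    negatePair : IdealPair G H → IdealPair G H
    negatePair p = record { a = ⊝ a ; b = b ; a∈ = aug-⊝a ; b∈ = b∈ }
      where
      open IdealPair p
      aug-⊝a : InIG G H (⊝ a)
      aug-⊝a = begin
        sumℤ G (⊝ a)  ≡⟨ sumℤ≡sum (⊝ a) ⟩
        sum (⊝ a)     ≡⟨ sum-neg a ⟩
        - sum a       ≡⟨ cong -_ (trans (sym (sumℤ≡sum a)) a∈) ⟩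
        - 0ℤ          ≡⟨⟩
        0ℤ            ∎

    sumPairs-negate : ∀ ps k → - sumPairs G H ps k ≡ sumPairs G H (map negatePair ps) k
    sumPairs-negate []       k = refl
    sumPairs-negate (p ∷ ps) k = begin
      - ((a · b) k + sumPairs G H ps k)
        ≡⟨ neg-distrib-+ ((a · b) k) _ ⟩
      - (a · b) k + - sumPairs G H ps k
        ≡⟨ cong₂ _+_ (sym (⊝·-apply a b k)) (sumPairs-negate ps k) ⟩
      ((⊝ a) · b) k + sumPairs G H (map negatePair ps) k
        ∎
      where open IdealPair p

    InIGIH-⊝ : ∀ {x} → InIGIH G H x → InIGIH G H (⊝ x)
    InIGIH-⊝ (ps , x≗ps) = map negatePair ps , λ k → trans (cong -_ (x≗ps k)) (sumPairs-negate ps k)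

    InIGIH-⊖ : ∀ {x y} → InIGIH G H x → InIGIH G H y → InIGIH G H (x ⊖ y)
    InIGIH-⊖ x∈ y∈ = InIGIH-⊕ x∈ (InIGIH-⊝ y∈)

    InIGIH-sumZG : ∀ {k} (f : Fin k → ZG G) → (∀ i → InIGIH G H (f i)) → InIGIH G H (sumZG G f)
    InIGIH-sumZG {zero}  f f∈ = InIGIH-zero
    InIGIH-sumZG {suc k} f f∈ = InIGIH-⊕ (f∈ zero) (InIGIH-sumZG (f ∘ suc) (f∈ ∘ suc))

    δ∈IH : ∀ {h} → mem h → InIH G H (δ G h)
    δ∈IH {h} h∈ = vanishes-off-H , aug-δ h
      where
      vanishes-off-H : ∀ k → ¬ mem k → δ G h k ≡ 0ℤ
      vanishes-off-H k k∉ = cong₂ _-_ (basis-≢ (λ h≡k → k∉ (subst mem h≡k h∈)))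
                                      (basis-≢ (λ e≡k → k∉ (subst mem e≡k e∈)))

    prodFin∈H : ∀ {k} (f : Fin k → El G) → (∀ i → mem (f i)) → mem (prodFin G f)
    prodFin∈H {zero}  f f∈ = e∈
    prodFin∈H {suc k} f f∈ = ∙∈ (f∈ zero) (prodFin∈H (f ∘ suc) (f∈ ∘ suc))

    sumδ-δprod∈IGIH : ∀ {k} (f : Fin k → El G) → (∀ i → mem (f i)) →
                      InIGIH G H (sumZG G (δ G ∘ f) ⊖ δ G (prodFin G f))
    sumδ-δprod∈IGIH {zero} f f∈ = InIGIH-resp (λ k → sym (0-[x-x]≡0 (basis G e k))) InIGIH-zero
      where
      0-[x-x]≡0 : ∀ x → 0ℤ - (x - x) ≡ 0ℤ
      0-[x-x]≡0 = solve-∀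
    sumδ-δprod∈IGIH {suc k} f f∈ =
      InIGIH-resp regroup (InIGIH-⊖ (sumδ-δprod∈IGIH (f ∘ suc) (f∈ ∘ suc))
                                    (InIGIH-· (aug-δ a) (δ∈IH (prodFin∈H (f ∘ suc) (f∈ ∘ suc)))))
      where
      a P : El G
      a = f zero
      P = prodFin G (f ∘ suc)
      S : ZG G
      S = sumZG G (δ G ∘ f ∘ suc)
      rearrange : ∀ s d dp m → s - dp - m ≡ d + s - (d + dp + m)
      rearrange = solve-∀
      regroup : S ⊖ δ G P ⊖ δ G a · δ G P ≗ sumZG G (δ G ∘ f) ⊖ δ G (a ∙ P)
      regroup k = trans (rearrange (S k) (δ G a k) (δ G P k) ((δ G a · δ G P) k))
                        (cong (λ z → sumZG G (δ G ∘ f) k - z) (sym (δ-∙ a P k)))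

    φ≡reps : ∀ {m} (reps : Fin m → El G) →
             (∀ i j x → mem (reps i ⁻¹ ∙ x) → mem (reps j ⁻¹ ∙ x) → i ≡ j) →
             ∀ j x → mem (reps j ⁻¹ ∙ x) → φ G H reps x ≡ reps j
    φ≡reps {suc m} reps unique j x x∈gⱼH with mem? (reps zero ⁻¹ ∙ x)
    ... | yes x∈g₀H = cong reps (unique zero j x x∈g₀H x∈gⱼH)
    φ≡reps {suc m} reps unique zero    x x∈g₀H | no x∉g₀H = contradiction x∈g₀H x∉g₀H
    φ≡reps {suc m} reps unique (suc j) x x∈gⱼH | no _ =
      φ≡reps (reps ∘ suc) (λ i j x p q → suc-injective (unique (suc i) (suc j) x p q)) j x x∈gⱼH

    a⁻¹[bc]∈H⇒c⁻¹[b⁻¹a]∈H : ∀ {a b c} → mem (a ⁻¹ ∙ (b ∙ c)) → mem (c ⁻¹ ∙ (b ⁻¹ ∙ a))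
    a⁻¹[bc]∈H⇒c⁻¹[b⁻¹a]∈H {a} {b} {c} p = subst mem inverse≡ (⁻¹∈ p)
      where
      inverse≡ : (a ⁻¹ ∙ (b ∙ c)) ⁻¹ ≡ c ⁻¹ ∙ (b ⁻¹ ∙ a)
      inverse≡ = begin
        (a ⁻¹ ∙ (b ∙ c)) ⁻¹  ≡⟨ ⁻¹-anti-homo-\\ a (b ∙ c) ⟩
        (b ∙ c) ⁻¹ ∙ a       ≡⟨ cong (_∙ a) (⁻¹-anti-homo-∙ b c) ⟩
        c ⁻¹ ∙ b ⁻¹ ∙ a      ≡⟨ assoc (c ⁻¹) (b ⁻¹) a ⟩
        c ⁻¹ ∙ (b ⁻¹ ∙ a)    ∎

    module Transversal {m} (reps : Fin m → El G) (transversal : IsTransversal G H m reps) where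

      cosetIndex : El G → Fin m
      cosetIndex x = proj₁ (proj₁ transversal x)

      cosetIndex-mem : ∀ x → mem (reps (cosetIndex x) ⁻¹ ∙ x)
      cosetIndex-mem x = proj₂ (proj₁ transversal x)

      cosetIndex-unique : ∀ {j x} → mem (reps j ⁻¹ ∙ x) → cosetIndex x ≡ j
      cosetIndex-unique {j} {x} = proj₂ transversal (cosetIndex x) j x (cosetIndex-mem x)

      φ≡reps∘cosetIndex : ∀ x → φ G H reps x ≡ reps (cosetIndex x)
      φ≡reps∘cosetIndex x = φ≡reps reps (proj₂ transversal) (cosetIndex x) x (cosetIndex-mem x)

      cosetIndex-translate⁻¹ : ∀ g j → cosetIndex (g ⁻¹ ∙ reps (cosetIndex (g ∙ reps j))) ≡ j
      cosetIndex-translate⁻¹ g j =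
        cosetIndex-unique (a⁻¹[bc]∈H⇒c⁻¹[b⁻¹a]∈H (cosetIndex-mem (g ∙ reps j)))

      translation : El G → Permutation′ m
      translation g = permutation (λ i → cosetIndex (g ∙ reps i)) (λ j → cosetIndex (g ⁻¹ ∙ reps j))
        (λ j → subst (λ g′ → cosetIndex (g′ ∙ reps (cosetIndex (g ⁻¹ ∙ reps j))) ≡ j)
                     (⁻¹-involutive g) (cosetIndex-translate⁻¹ (g ⁻¹) j))
        (cosetIndex-translate⁻¹ g)

      module _ (g : El G) where

        p h : Fin m → El G
        p i = φ G H reps (g ∙ reps i)
        h i = p i ⁻¹ ∙ (g ∙ reps i)

        S : ZG G
        S = sumZG G (basis G ∘ reps)

        δp·δh : Fin m → ZG G
        δp·δh i = δ G (p i) · δ G (h i)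

        h∈H : ∀ i → mem (h i)
        h∈H i = subst (λ r → mem (r ⁻¹ ∙ (g ∙ reps i)))
                      (sym (φ≡reps∘cosetIndex (g ∙ reps i))) (cosetIndex-mem (g ∙ reps i))

        sum-basis-reps≡sum-basis-p : ∀ k → sum (λ i → basis G (reps i) k) ≡ sum (λ i → basis G (p i) k)
        sum-basis-reps≡sum-basis-p k = begin
          sum (λ i → basis G (reps i) k)
            ≡⟨ sum-permute (λ i → basis G (reps i) k) (translation g) ⟩
          sum (λ i → basis G (reps (cosetIndex (g ∙ reps i))) k)
            ≡⟨ sum-cong-≗ (λ i → cong (λ r → basis G r k) (sym (φ≡reps∘cosetIndex (g ∙ reps i)))) ⟩
          sum (λ i → basis G (p i) k)
            ∎

        pᵢhᵢ-pᵢ : ∀ i k → basis G (g ∙ reps i) k - basis G (p i) k ≡ δ G (h i) k + δp·δh i k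
        pᵢhᵢ-pᵢ i k = begin
          basis G (g ∙ reps i) k - basis G (p i) k
            ≡⟨ cong (λ x → basis G x k - basis G (p i) k) (\\-leftDividesˡ (p i) (g ∙ reps i)) ⟨
          basis G (p i ∙ h i) k - basis G (p i) k
            ≡⟨ basis-∙-sub (p i) (h i) k ⟩
          δ G (h i) k + δp·δh i k
            ∎

        δ·S : δ G g · S ≗ sumZG G (δ G ∘ h) ⊕ sumZG G δp·δh
        δ·S k = begin
          (δ G g · S) k
            ≡⟨ δ·-apply g S k ⟩
          S (g ⁻¹ ∙ k) - S k
            ≡⟨ cong₂ _-_ (sumZG-apply (basis G ∘ reps) (g ⁻¹ ∙ k)) (sumZG-apply (basis G ∘ reps) k) ⟩
          sum (λ i → basis G (reps i) (g ⁻¹ ∙ k)) - sum (λ i → basis G (reps i) k)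
            ≡⟨ cong₂ _-_ (sum-cong-≗ (λ i → basis-translate g (reps i) k))
                         (sum-basis-reps≡sum-basis-p k) ⟩
          sum (λ i → basis G (g ∙ reps i) k) - sum (λ i → basis G (p i) k)
            ≡⟨ sum-sub (λ i → basis G (g ∙ reps i) k) (λ i → basis G (p i) k) ⟨
          sum (λ i → basis G (g ∙ reps i) k - basis G (p i) k)
            ≡⟨ sum-cong-≗ (λ i → pᵢhᵢ-pᵢ i k) ⟩
          sum (λ i → δ G (h i) k + δp·δh i k)
            ≡⟨ ∑-distrib-+ (λ i → δ G (h i) k) (λ i → δp·δh i k) ⟩
          sum (λ i → δ G (h i) k) + sum (λ i → δp·δh i k)
            ≡⟨ cong₂ _+_ (sumZG-apply (δ G ∘ h) k) (sumZG-apply δp·δh k) ⟨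
          (sumZG G (δ G ∘ h) ⊕ sumZG G δp·δh) k
            ∎

        δ·S⊖δVer∈IGIH : InIGIH G H (δ G g · S ⊖ δ G (Ver G H reps g))
        δ·S⊖δVer∈IGIH = InIGIH-resp regroup (InIGIH-⊕ sum-δp·δh∈IGIH (sumδ-δprod∈IGIH h h∈H))
          where
          sum-δp·δh∈IGIH : InIGIH G H (sumZG G δp·δh)
          sum-δp·δh∈IGIH = InIGIH-sumZG δp·δh (λ i → InIGIH-· (aug-δ (p i)) (δ∈IH (h∈H i)))
          swap : ∀ x y z → x + (y - z) ≡ y + x - z
          swap = solve-∀
          regroup : sumZG G δp·δh ⊕ (sumZG G (δ G ∘ h) ⊖ δ G (prodFin G h)) ≗ δ G g · S ⊖ δ G (Ver G H reps g)
          regroup k = trans (swap (sumZG G δp·δh k) (sumZG G (δ G ∘ h) k) (δ G (prodFin G h) k))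
                            (cong (_- δ G (prodFin G h) k) (sym (δ·S k)))

-- The congruence (g − 1)·Σ gᵢ ≡ Ver(g) − 1 (mod I_G I_H) holds for every transversal; G′ ⊆ H and
-- |H| ∣ [G:H] only serve in the paper to make the maps of the diagram well defined.
lemma3p7 : (G : FinGroup) (H : NormalSubgroup G) →
    (∀ x → Derived G x → NormalSubgroup.mem H x) →
    (m : ℕ) (reps : Fin m → El G) → IsTransversal G H m reps →
    card G H ∣ m →
    ∀ (g : El G) →
    InIGIH G H (_-G_ G (_*G_ G (δ G g) (sumZG G (λ i → basis G (reps i))))
    (δ G (Ver G H reps g)))
lemma3p7 G H _ m reps transversal _ = Transversal.δ·S⊖δVer∈IGIH G H reps transversal
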